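{- Let $p$ be a prime with $p\equiv 3\pmod 4$ and let $\epsilon$ be the fundamental unit of $F=\mathbb{Q}(\sqrt{p})$. Then $\sqrt{\epsilon/2}\in F$, and $\sqrt{\epsilon/2}\equiv (1+\sqrt{p})/2 \pmod{O_F}$.
   Context: $O_F=\mathbb{Z}[\sqrt p]$ is the ring of integers of $F$; the fundamental unit $\epsilon$ is the unit $\epsilon>1$ with $O_F^\times=\{\pm\epsilon^a:a\in\mathbb{Z}\}$. -}

module Defs where

open import Data.Nat as ℕ using (ℕ; zero; suc)
open import Data.Integer as ℤ using (ℤ; +_)
open import Data.Rational as ℚ using (ℚ; ½)
open import Data.Product using (Σ; ∃; _×_; _,_)
open import Data.Sum using (_⊎_)
open import Relation.Binary.PropositionalEquality using (_≡_)

-- The ring Z[√p] (= O_F for p ≡ 3 mod 4): a + b√p with a b : ℤ.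

record ℤ√ : Set where
  constructor _+_√
  field
    re im : ℤ
open ℤ√ public

module _ (p : ℕ) where
  _*ᶻ_ : ℤ√ → ℤ√ → ℤ√
  (a + b √) *ᶻ (c + d √) =
    ((a ℤ.* c) ℤ.+ ((+ p) ℤ.* (b ℤ.* d))) + ((a ℤ.* d) ℤ.+ (b ℤ.* c)) √

  oneᶻ : ℤ√
  oneᶻ = (+ 1) + (+ 0) √

  negᶻ : ℤ√ → ℤ√
  negᶻ (a + b √) = (ℤ.- a) + (ℤ.- b) √

  powᶻ : ℤ√ → ℕ → ℤ√
  powᶻ e zero = oneᶻ
  powᶻ e (suc n) = e *ᶻ powᶻ e n

  IsUnit : ℤ√ → Set
  IsUnit u = ∃ λ v → u *ᶻ v ≡ oneᶻ

  -- The real number a + b√p (√p the positive real square root) is > 0.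
  -- Decided by integer arithmetic since ℝ is unavailable:
  --   both a,b ≥ 0 and not both 0; or a > 0 > b with a² > p b²;
  --   or b > 0 > a with p b² > a².
  RealPos : ℤ√ → Set
  RealPos (a + b √) =
      (ℤ.0ℤ ℤ.≤ a × ℤ.0ℤ ℤ.≤ b × (ℤ.0ℤ ℤ.< a ⊎ ℤ.0ℤ ℤ.< b))
    ⊎ (ℤ.0ℤ ℤ.< a × b ℤ.< ℤ.0ℤ × (+ p) ℤ.* (b ℤ.* b) ℤ.< a ℤ.* a)
    ⊎ (a ℤ.< ℤ.0ℤ × ℤ.0ℤ ℤ.< b × a ℤ.* a ℤ.< (+ p) ℤ.* (b ℤ.* b))

  RealGt1 : ℤ√ → Set
  RealGt1 (a + b √) = RealPos ((a ℤ.- ℤ.1ℤ) + b √)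

  -- ε is the fundamental unit: ε unit, ε > 1, and every unit is ± ε^a, a ∈ ℤ.
  -- For a = n ≥ 0: u = ±ε^n; for a = -n ≤ 0: u ε^n = ±1.
  IsFundamentalUnit : ℤ√ → Set
  IsFundamentalUnit ε =
    IsUnit ε × RealGt1 ε ×
    (∀ u → IsUnit u → ∃ λ (n : ℕ) →
        u ≡ powᶻ ε n ⊎ u ≡ negᶻ (powᶻ ε n)
      ⊎ u *ᶻ powᶻ ε n ≡ oneᶻ ⊎ u *ᶻ powᶻ ε n ≡ negᶻ oneᶻ)

record F√ : Set where
  constructor _+_√F
  field
    reF imF : ℚ
open F√ public

module _ (p : ℕ) where
  _*F_ : F√ → F√ → F√
  (a + b √F) *F (c + d √F) =
    ((a ℚ.* c) ℚ.+ ((+ p ℚ./ 1) ℚ.* (b ℚ.* d))) + ((a ℚ.* d) ℚ.+ (b ℚ.* c)) √F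

_-F_ : F√ → F√ → F√
(a + b √F) -F (c + d √F) = (a ℚ.- c) + (b ℚ.- d) √F

ι : ℤ√ → F√
ι (a + b √) = (a ℚ./ 1) + (b ℚ./ 1) √F

half : F√ → F√
half (a + b √F) = (½ ℚ.* a) + (½ ℚ.* b) √F

IsIntℚ : ℚ → Set
IsIntℚ q = ∃ λ (z : ℤ) → q ≡ z ℚ./ 1

InO : F√ → Set
InO (a + b √F) = IsIntℚ a × IsIntℚ b

halfOnePlusSqrt : F√
halfOnePlusSqrt = ½ + ½ √F

-- The norm a² − p b² of ε = a + b√p is ±1, and −1 is impossible because p ≡ 3 (mod 4) while
-- squares are 0 or 1 (mod 4); as ε > 1, both a and b are positive, so (a − 1)(a + 1) = p b².
-- If a were odd, a² − 1 = 4k(k + 1) with k and k + 1 coprime would make them s² and p t² in some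
-- order, and η = s + t√p would be a unit with η² = ε, hence a unit with positive coordinates
-- smaller than ε. So a is even, a − 1 and a + 1 are coprime odd numbers, hence s² and p t² in
-- some order with b = s t and s, t odd; then δ = (s + t√p)/2 satisfies δ² = (2a + 2b√p)/4 = ε/2
-- and δ − (1 + √p)/2 = (s − 1)/2 + ((t − 1)/2)√p ∈ O_F.

module Submission where

open import Defs
open import Data.Nat using (ℕ; zero; suc; _+_; _*_; _/_; _%_; _≤_; _<_; z≤n; s≤s; NonZero; ≢-nonZero; >-nonZero⁻¹)
open import Data.Nat.Properties
open import Data.Nat.DivMod using (m≡m%n+[m/n]*n; m%n<n; %-distribˡ-+; %-distribˡ-*; m*[n/m]≡n)
open import Data.Nat.Divisibility using (_∣_; divides; ∣-trans; ∣-antisym; ∣⇒≤; 0∣⇒≡0)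
import Data.Nat.Coprimality as Coprimality
open Coprimality using (Coprime; coprime-divisor; coprime-/gcd; coprime-+; 0-coprimeTo-m⇒m≡1; 1-coprimeTo)
open import Data.Nat.GCD using (gcd; gcd[m,n]∣m; gcd[m,n]∣n; gcd[m,n]≢0)
open import Data.Nat.Primality using (Prime; euclidsLemma; prime⇒nonZero)
open import Data.Nat.Tactic.RingSolver using (solve-∀)
import Data.Integer as ℤ
open ℤ using (ℤ; +_; -[1+_]; ∣_∣; 0ℤ; 1ℤ; -1ℤ)
import Data.Integer.Properties as ℤ
import Data.Integer.Tactic.RingSolver as ℤ-Solver
import Data.Rational as ℚ
open ℚ using (ℚ; ½; 1ℚ)
import Data.Rational.Properties as ℚ
open import Data.Rational.Solver using (module +-*-Solver)
import Data.Rational.Unnormalised as ℚᵘ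
open ℚᵘ using (mkℚᵘ; *≡*)
import Data.Rational.Unnormalised.Properties as ℚᵘ
open import Data.Product using (∃; ∃₂; _×_; _,_)
open import Data.Sum as Sum using (_⊎_; inj₁; inj₂)
open import Data.Empty using (⊥; ⊥-elim)
open import Function using (_∘_; case_of_)
open import Relation.Binary.PropositionalEquality

data EvenOrOdd : ℕ → Set where
  even : ∀ k → EvenOrOdd (2 * k)
  odd  : ∀ k → EvenOrOdd (1 + 2 * k)

evenOrOdd : ∀ n → EvenOrOdd n
evenOrOdd zero = even 0
evenOrOdd (suc n) with evenOrOdd n
... | even k = odd k
... | odd k = subst EvenOrOdd (*-distribˡ-+ 2 1 k) (even (suc k))

Odd : ℕ → Set
Odd n = ∃ λ k → n ≡ 1 + 2 * k

odd-*ʳ : ∀ m {n} → Odd (m * n) → Odd n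
odd-*ʳ m {n} (k , mn≡1+2k) with evenOrOdd n
... | odd j = j , refl
... | even j = ⊥-elim (even≢odd (m * j) k (trans (shuffle m j) mn≡1+2k))
  where
  shuffle : ∀ m j → 2 * (m * j) ≡ m * (2 * j)
  shuffle = solve-∀

odd-* : ∀ {m n} → Odd m → Odd n → Odd (m * n)
odd-* (i , refl) (j , refl) = i + j + 2 * (i * j) , identity i j
  where
  identity : ∀ i j → (1 + 2 * i) * (1 + 2 * j) ≡ 1 + 2 * (i + j + 2 * (i * j))
  identity = solve-∀

odd-*-odd : ∀ {m n} → Odd (m * n) → Odd m × Odd n
odd-*-odd {m} {n} mn-odd = odd-*ʳ n (subst Odd (*-comm m n) mn-odd) , odd-*ʳ m mn-odd

[3mod4]⇒odd : ∀ {p} → p % 4 ≡ 3 → Odd p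
[3mod4]⇒odd {p} p%4≡3 = 1 + 2 * (p / 4) , (begin
  p                    ≡⟨ m≡m%n+[m/n]*n p 4 ⟩
  p % 4 + p / 4 * 4    ≡⟨ cong (_+ p / 4 * 4) p%4≡3 ⟩
  3 + p / 4 * 4        ≡⟨ identity (p / 4) ⟩
  1 + 2 * (1 + 2 * (p / 4)) ∎)
  where
  open ≡-Reasoning
  identity : ∀ q → 3 + q * 4 ≡ 1 + 2 * (1 + 2 * q)
  identity = solve-∀

square%4 : ∀ n → (n * n) % 4 ≡ 0 ⊎ (n * n) % 4 ≡ 1
square%4 n = subst (λ r → r ≡ 0 ⊎ r ≡ 1) (sym (%-distribˡ-* n n 4)) (residue (n % 4) (m%n<n n 4))
  where
  residue : ∀ r → r < 4 → (r * r) % 4 ≡ 0 ⊎ (r * r) % 4 ≡ 1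
  residue 0 _ = inj₁ refl
  residue 1 _ = inj₂ refl
  residue 2 _ = inj₁ refl
  residue 3 _ = inj₂ refl
  residue (suc (suc (suc (suc _)))) (s≤s (s≤s (s≤s (s≤s ()))))

1+square≢[3mod4]*square : ∀ {p} → p % 4 ≡ 3 → ∀ a b → 1 + a * a ≢ p * (b * b)
1+square≢[3mod4]*square {p} p%4≡3 a b eq = distinct (square%4 a) (square%4 b) residues
  where
  residues : (1 + (a * a) % 4) % 4 ≡ (3 * ((b * b) % 4)) % 4
  residues = begin
    (1 + (a * a) % 4) % 4          ≡⟨ %-distribˡ-+ 1 (a * a) 4 ⟨
    (1 + a * a) % 4                ≡⟨ cong (_% 4) eq ⟩
    (p * (b * b)) % 4              ≡⟨ %-distribˡ-* p (b * b) 4 ⟩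
    (p % 4 * ((b * b) % 4)) % 4    ≡⟨ cong (λ r → (r * ((b * b) % 4)) % 4) p%4≡3 ⟩
    (3 * ((b * b) % 4)) % 4        ∎
    where open ≡-Reasoning
  distinct : ∀ {x y} → x ≡ 0 ⊎ x ≡ 1 → y ≡ 0 ⊎ y ≡ 1 → (1 + x) % 4 ≢ (3 * y) % 4
  distinct (inj₁ refl) (inj₁ refl) ()
  distinct (inj₁ refl) (inj₂ refl) ()
  distinct (inj₂ refl) (inj₁ refl) ()
  distinct (inj₂ refl) (inj₂ refl) ()

-- With s = gcd x z, x / s divides s (being coprime to z / s) and s divides x / s (being coprime
-- to y), so x = s².
coprime-product-square : ∀ {x y z} → Coprime x y → x * y ≡ z * z →
  ∃₂ λ s t → x ≡ s * s × y ≡ t * t × z ≡ s * t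
coprime-product-square {zero} {y} {zero} x⊥y _ = 0 , 1 , refl , 0-coprimeTo-m⇒m≡1 x⊥y , refl
coprime-product-square {zero} {y} {suc _} _ ()
coprime-product-square {x@(suc _)} {y} {z} x⊥y xy≡zz = s , z′ , x≡ss , y≡z′z′ , z≡sz′
  where
  s = gcd x z
  instance
    s≢0 : NonZero s
    s≢0 = ≢-nonZero (gcd[m,n]≢0 x z (inj₁ λ ()))
  x′ = x / s
  z′ = z / s
  x≡sx′ : x ≡ s * x′
  x≡sx′ = sym (m*[n/m]≡n (gcd[m,n]∣m x z))
  z≡sz′ : z ≡ s * z′
  z≡sz′ = sym (m*[n/m]≡n (gcd[m,n]∣n x z))
  x′y≡sz′z′ : x′ * y ≡ s * (z′ * z′)
  x′y≡sz′z′ = *-cancelˡ-≡ _ _ s (begin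
    s * (x′ * y)         ≡⟨ *-assoc s x′ y ⟨
    s * x′ * y           ≡⟨ cong (_* y) x≡sx′ ⟨
    x * y                ≡⟨ xy≡zz ⟩
    z * z                ≡⟨ cong₂ _*_ z≡sz′ z≡sz′ ⟩
    s * z′ * (s * z′)    ≡⟨ regroup s z′ ⟩
    s * (s * (z′ * z′))  ∎)
    where
    open ≡-Reasoning
    regroup : ∀ a b → a * b * (a * b) ≡ a * (a * (b * b))
    regroup = solve-∀
  x′∣s : x′ ∣ s
  x′∣s = coprime-divisor x′⊥z′ (coprime-divisor x′⊥z′
    (divides y (trans (regroup s z′) (trans (sym x′y≡sz′z′) (*-comm x′ y)))))
    where
    x′⊥z′ : Coprime x′ z′
    x′⊥z′ = coprime-/gcd x z
    regroup : ∀ a b → b * (b * a) ≡ a * (b * b)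
    regroup = solve-∀
  s∣x′ : s ∣ x′
  s∣x′ = coprime-divisor s⊥y (divides (z′ * z′) (trans (*-comm y x′) (trans x′y≡sz′z′ (*-comm s _))))
    where
    s⊥y : Coprime s y
    s⊥y (d∣s , d∣y) = x⊥y (∣-trans d∣s (gcd[m,n]∣m x z) , d∣y)
  x′≡s : x′ ≡ s
  x′≡s = ∣-antisym x′∣s s∣x′
  x≡ss : x ≡ s * s
  x≡ss = trans x≡sx′ (cong (s *_) x′≡s)
  y≡z′z′ : y ≡ z′ * z′
  y≡z′z′ = *-cancelˡ-≡ _ _ s (trans (cong (_* y) (sym x′≡s)) x′y≡sz′z′)

coprime-product-n*square : ∀ {n x y z} .{{_ : NonZero n}} → Coprime x y → x * y ≡ n * (z * z) →
  n ∣ x → ∃₂ λ s t → x ≡ n * (t * t) × y ≡ s * s × z ≡ s * t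
coprime-product-n*square {n} {x} {y} {z} x⊥y xy≡nzz (divides x′ x≡x′n) =
  let a , b , x′≡aa , y≡bb , z≡ab = coprime-product-square x′⊥y x′y≡zz
  in b , a , trans x≡nx′ (cong (n *_) x′≡aa) , y≡bb , trans z≡ab (*-comm a b)
  where
  x≡nx′ : x ≡ n * x′
  x≡nx′ = trans x≡x′n (*-comm x′ n)
  x′⊥y : Coprime x′ y
  x′⊥y (d∣x′ , d∣y) = x⊥y (∣-trans d∣x′ (divides n x≡nx′) , d∣y)
  x′y≡zz : x′ * y ≡ z * z
  x′y≡zz = *-cancelˡ-≡ _ _ n (trans (sym (*-assoc n x′ y)) (trans (cong (_* y) (sym x≡nx′)) xy≡nzz))

coprime-product-prime*square : ∀ {p x y z} → Prime p → Coprime x y → x * y ≡ p * (z * z) →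
  ∃₂ λ s t → (x ≡ s * s × y ≡ p * (t * t) ⊎ x ≡ p * (t * t) × y ≡ s * s) × z ≡ s * t
coprime-product-prime*square {p} {x} {y} {z} p-prime x⊥y xy≡pzz
  with euclidsLemma x y p-prime (divides (z * z) (trans xy≡pzz (*-comm p _)))
... | inj₁ p∣x =
  let s , t , x≡ptt , y≡ss , z≡st = coprime-product-n*square x⊥y xy≡pzz p∣x
  in s , t , inj₂ (x≡ptt , y≡ss) , z≡st
  where instance _ = prime⇒nonZero p-prime
... | inj₂ p∣y =
  let s , t , y≡ptt , x≡ss , z≡st =
        coprime-product-n*square (Coprimality.sym x⊥y) (trans (*-comm y x) xy≡pzz) p∣y
  in s , t , inj₁ (x≡ss , y≡ptt) , z≡st
  where instance _ = prime⇒nonZero p-prime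

consecutive-coprime : ∀ k → Coprime k (suc k)
consecutive-coprime k = subst (Coprime k) (+-comm k 1) (Coprimality.sym (coprime-+ (1-coprimeTo k)))

2-coprime-odd : ∀ c → Coprime 2 (1 + 2 * c)
2-coprime-odd c {0} (0∣2 , _) = case 0∣⇒≡0 0∣2 of λ ()
2-coprime-odd c {1} _ = refl
2-coprime-odd c {2} (_ , divides q odd≡q*2) = ⊥-elim (even≢odd q c (trans (*-comm 2 q) (sym odd≡q*2)))
2-coprime-odd c {suc (suc (suc _))} (d∣2 , _) = case ∣⇒≤ d∣2 of λ { (s≤s (s≤s ())) }

odd-coprime-+2 : ∀ c → Coprime (1 + 2 * c) (1 + 2 * c + 2)
odd-coprime-+2 c = Coprimality.sym (coprime-+ (2-coprime-odd c))

sum-of-parts : ∀ p s t {x y} → (x ≡ s * s × y ≡ p * (t * t) ⊎ x ≡ p * (t * t) × y ≡ s * s) →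
  x + y ≡ s * s + p * (t * t)
sum-of-parts p s t (inj₁ (refl , refl)) = refl
sum-of-parts p s t (inj₂ (refl , refl)) = +-comm (p * (t * t)) (s * s)

consecutive-split : ∀ p s t {k} → (k ≡ s * s × suc k ≡ p * (t * t) ⊎ k ≡ p * (t * t) × suc k ≡ s * s) →
  s * s ≡ suc (p * (t * t)) ⊎ p * (t * t) ≡ suc (s * s)
consecutive-split p s t (inj₁ (refl , 1+k≡ptt)) = inj₂ (sym 1+k≡ptt)
consecutive-split p s t (inj₂ (refl , 1+k≡ss)) = inj₁ (sym 1+k≡ss)

pell-even-split : ∀ {p k B} → Prime p → (2 * k) * (2 * k) ≡ suc (p * (B * B)) →
  ∃₂ λ i j → (1 + 2 * i) * (1 + 2 * i) + p * ((1 + 2 * j) * (1 + 2 * j)) ≡ 2 * k + 2 * k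
           × (1 + 2 * i) * (1 + 2 * j) ≡ B
pell-even-split {k = zero} _ ()
pell-even-split {p} {suc c} {B} p-prime A²≡1+pB² with suc-injective (trans (expand c) A²≡1+pB²)
  where
  expand : ∀ c → suc ((1 + 2 * c) * (1 + 2 * c + 2)) ≡ 2 * suc c * (2 * suc c)
  expand = solve-∀
... | xy≡pB² with coprime-product-prime*square {z = B} p-prime (odd-coprime-+2 c) xy≡pB²
... | s , t , parts , refl with odd-*-odd {s} {t} (odd-*ʳ (s * t) (odd-*ʳ p (subst Odd xy≡pB² xy-odd)))
  where
  xy-odd : Odd ((1 + 2 * c) * (1 + 2 * c + 2))
  xy-odd = odd-* (c , refl) (suc c , identity c)
    where
    identity : ∀ c → 1 + 2 * c + 2 ≡ 1 + 2 * suc c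
    identity = solve-∀
... | (i , refl) , (j , refl) =
  i , j , trans (sym (sum-of-parts p (1 + 2 * i) (1 + 2 * j) parts)) (identity c) , refl
  where
  identity : ∀ c → 1 + 2 * c + (1 + 2 * c + 2) ≡ 2 * suc c + 2 * suc c
  identity = solve-∀

pell-odd-square : ∀ {p k B} → Prime p → Odd p → (1 + 2 * k) * (1 + 2 * k) ≡ suc (p * (B * B)) →
  ∃₂ λ S T → (S * S ≡ suc (p * (T * T)) ⊎ p * (T * T) ≡ suc (S * S))
           × 1 + 2 * k ≡ S * S + p * (T * T) × B ≡ S * T + T * S
pell-odd-square {p} {k} {B} p-prime p-odd A²≡1+pB²
  with suc-injective (trans (sym (expand k)) A²≡1+pB²) | evenOrOdd B
  where
  expand : ∀ k → (1 + 2 * k) * (1 + 2 * k) ≡ suc (2 * (2 * (k * suc k)))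
  expand = solve-∀
... | 4k[k+1]≡pB² | odd j =
  let X , pB²≡1+2X = odd-* p-odd (odd-* (j , refl) (j , refl))
  in ⊥-elim (even≢odd (2 * (k * suc k)) X (trans 4k[k+1]≡pB² pB²≡1+2X))
... | 4k[k+1]≡pB² | even m
  with coprime-product-prime*square {z = m} p-prime (consecutive-coprime k)
         (*-cancelˡ-≡ _ _ 4 (trans (regroup k) (trans 4k[k+1]≡pB² (scale p m))))
  where
  regroup : ∀ k → 4 * (k * suc k) ≡ 2 * (2 * (k * suc k))
  regroup = solve-∀
  scale : ∀ p m → p * (2 * m * (2 * m)) ≡ 4 * (p * (m * m))
  scale = solve-∀
... | S , T , parts , refl =
  S , T , consecutive-split p S T parts , trans (identity k) (sum-of-parts p S T parts) , double S T
  where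
  identity : ∀ k → 1 + 2 * k ≡ k + suc k
  identity = solve-∀
  double : ∀ S T → 2 * (S * T) ≡ S * T + T * S
  double = solve-∀

∣i∣≡1⇒i≡±1 : ∀ {i} → ∣ i ∣ ≡ 1 → i ≡ 1ℤ ⊎ i ≡ -1ℤ
∣i∣≡1⇒i≡±1 {+ _} refl = inj₁ refl
∣i∣≡1⇒i≡±1 { -[1+ _ ]} refl = inj₂ refl

i*i≡+∣i∣*∣i∣ : ∀ i → i ℤ.* i ≡ + (∣ i ∣ * ∣ i ∣)
i*i≡+∣i∣*∣i∣ (+ n) = sym (ℤ.pos-* n n)
i*i≡+∣i∣*∣i∣ -[1+ n ] = refl

+m-+n≡1⇒m≡1+n : ∀ {m n} → + m ℤ.- + n ≡ 1ℤ → m ≡ suc n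
+m-+n≡1⇒m≡1+n {m} {n} eq = ℤ.+-injective (trans (shift (+ m) (+ n)) (cong (ℤ._+ + n) eq))
  where
  shift : ∀ i j → i ≡ (i ℤ.- j) ℤ.+ j
  shift = ℤ-Solver.solve-∀

+m-+n≡-1⇒n≡1+m : ∀ {m n} → + m ℤ.- + n ≡ -1ℤ → n ≡ suc m
+m-+n≡-1⇒n≡1+m {m} {n} eq = ℤ.+-injective (trans (shift (+ m) (+ n)) (cong (λ k → ℤ.- k ℤ.+ + m) eq))
  where
  shift : ∀ i j → j ≡ ℤ.- (i ℤ.- j) ℤ.+ i
  shift = ℤ-Solver.solve-∀

ℕ√ : ℕ → ℕ → ℤ√
ℕ√ a b = (+ a) + (+ b) √

module _ (p : ℕ) where

  private
    infixl 7 _·_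
    _·_ : ℤ√ → ℤ√ → ℤ√
    _·_ = _*ᶻ_ p

  norm : ℤ√ → ℤ
  norm (a + b √) = a ℤ.* a ℤ.- + p ℤ.* (b ℤ.* b)

  conj : ℤ√ → ℤ√
  conj (a + b √) = a + ℤ.- b √

  norm-* : ∀ x y → norm (x · y) ≡ norm x ℤ.* norm y
  norm-* (a + b √) (c + d √) = identity a b c d (+ p)
    where
    identity : ∀ a b c d P →
      (a ℤ.* c ℤ.+ P ℤ.* (b ℤ.* d)) ℤ.* (a ℤ.* c ℤ.+ P ℤ.* (b ℤ.* d))
        ℤ.- P ℤ.* ((a ℤ.* d ℤ.+ b ℤ.* c) ℤ.* (a ℤ.* d ℤ.+ b ℤ.* c))
      ≡ (a ℤ.* a ℤ.- P ℤ.* (b ℤ.* b)) ℤ.* (c ℤ.* c ℤ.- P ℤ.* (d ℤ.* d))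
    identity = ℤ-Solver.solve-∀

  ·-conj : ∀ x → x · conj x ≡ norm x + 0ℤ √
  ·-conj (a + b √) = cong₂ _+_√ (re-identity a b (+ p)) (im-identity a b)
    where
    re-identity : ∀ a b P → a ℤ.* a ℤ.+ P ℤ.* (b ℤ.* ℤ.- b) ≡ a ℤ.* a ℤ.- P ℤ.* (b ℤ.* b)
    re-identity = ℤ-Solver.solve-∀
    im-identity : ∀ a b → a ℤ.* ℤ.- b ℤ.+ b ℤ.* a ≡ 0ℤ
    im-identity = ℤ-Solver.solve-∀

  norm-one : norm (oneᶻ p) ≡ 1ℤ
  norm-one = identity (+ p)
    where
    identity : ∀ P → 1ℤ ℤ.* 1ℤ ℤ.- P ℤ.* (0ℤ ℤ.* 0ℤ) ≡ 1ℤ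
    identity = ℤ-Solver.solve-∀

  ·-neg-conj : ∀ x → x · negᶻ p (conj x) ≡ (ℤ.- norm x) + 0ℤ √
  ·-neg-conj (a + b √) = cong₂ _+_√ (re-identity a b (+ p)) (im-identity a b)
    where
    re-identity : ∀ a b P →
      a ℤ.* ℤ.- a ℤ.+ P ℤ.* (b ℤ.* ℤ.- ℤ.- b) ≡ ℤ.- (a ℤ.* a ℤ.- P ℤ.* (b ℤ.* b))
    re-identity = ℤ-Solver.solve-∀
    im-identity : ∀ a b → a ℤ.* ℤ.- ℤ.- b ℤ.+ b ℤ.* ℤ.- a ≡ 0ℤ
    im-identity = ℤ-Solver.solve-∀

  unit⇒norm≡±1 : ∀ {x} → IsUnit p x → norm x ≡ 1ℤ ⊎ norm x ≡ -1ℤ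
  unit⇒norm≡±1 {x} (y , xy≡1) = ∣i∣≡1⇒i≡±1 (m*n≡1⇒m≡1 ∣ norm x ∣ ∣ norm y ∣ (begin
    ∣ norm x ∣ * ∣ norm y ∣    ≡⟨ ℤ.abs-* (norm x) (norm y) ⟨
    ∣ norm x ℤ.* norm y ∣      ≡⟨ cong ∣_∣ (norm-* x y) ⟨
    ∣ norm (x · y) ∣           ≡⟨ cong (λ z → ∣ norm z ∣) xy≡1 ⟩
    ∣ norm (oneᶻ p) ∣          ≡⟨ cong ∣_∣ norm-one ⟩
    1                          ∎))
    where open ≡-Reasoning

  norm≡±1⇒unit : ∀ {x} → norm x ≡ 1ℤ ⊎ norm x ≡ -1ℤ → IsUnit p x
  norm≡±1⇒unit {x} (inj₁ nx≡1) = conj x , trans (·-conj x) (cong (_+ 0ℤ √) nx≡1)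
  norm≡±1⇒unit {x} (inj₂ nx≡-1) = negᶻ p (conj x) , trans (·-neg-conj x) (cong (λ n → (ℤ.- n) + 0ℤ √) nx≡-1)

  norm≡∣re∣²-p∣im∣² : ∀ x → norm x ≡ + (∣ re x ∣ * ∣ re x ∣) ℤ.- + (p * (∣ im x ∣ * ∣ im x ∣))
  norm≡∣re∣²-p∣im∣² (a + b √) =
    cong₂ ℤ._-_ (i*i≡+∣i∣*∣i∣ a) (trans (cong (+ p ℤ.*_) (i*i≡+∣i∣*∣i∣ b)) (sym (ℤ.pos-* p _)))

  Norm±1 : ℤ√ → Set
  Norm±1 x = ∣ re x ∣ * ∣ re x ∣ ≡ suc (p * (∣ im x ∣ * ∣ im x ∣))
           ⊎ p * (∣ im x ∣ * ∣ im x ∣) ≡ suc (∣ re x ∣ * ∣ re x ∣)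

  unit⇒Norm±1 : ∀ {x} → IsUnit p x → Norm±1 x
  unit⇒Norm±1 {x} unit with unit⇒norm≡±1 {x} unit
  ... | inj₁ nx≡1 = inj₁ (+m-+n≡1⇒m≡1+n (trans (sym (norm≡∣re∣²-p∣im∣² x)) nx≡1))
  ... | inj₂ nx≡-1 = inj₂ (+m-+n≡-1⇒n≡1+m (trans (sym (norm≡∣re∣²-p∣im∣² x)) nx≡-1))

  Norm±1⇒unit : ∀ {x} → Norm±1 x → IsUnit p x
  Norm±1⇒unit {x} = norm≡±1⇒unit {x} ∘ Sum.map
    (λ a²≡1+pb² → trans (norm≡∣re∣²-p∣im∣² x)
                    (trans (cong (λ n → + n ℤ.- + pb²) a²≡1+pb²) (cancel-1+ (+ pb²))))
    (λ pb²≡1+a² → trans (norm≡∣re∣²-p∣im∣² x)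
                    (trans (cong (λ n → + a² ℤ.- + n) pb²≡1+a²) (cancel-+1 (+ a²))))
    where
    a² = ∣ re x ∣ * ∣ re x ∣
    pb² = p * (∣ im x ∣ * ∣ im x ∣)
    cancel-1+ : ∀ i → 1ℤ ℤ.+ i ℤ.- i ≡ 1ℤ
    cancel-1+ = ℤ-Solver.solve-∀
    cancel-+1 : ∀ i → i ℤ.- (1ℤ ℤ.+ i) ≡ -1ℤ
    cancel-+1 = ℤ-Solver.solve-∀

  ℕ√-· : ∀ a b c d → ℕ√ a b · ℕ√ c d ≡ ℕ√ (a * c + p * (b * d)) (a * d + b * c)
  ℕ√-· a b c d = cong₂ _+_√
    (trans (cong₂ ℤ._+_ (sym (ℤ.pos-* a c)) (trans (cong (+ p ℤ.*_) (sym (ℤ.pos-* b d))) (sym (ℤ.pos-* p _))))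
           (sym (ℤ.pos-+ (a * c) _)))
    (trans (cong₂ ℤ._+_ (sym (ℤ.pos-* a d)) (sym (ℤ.pos-* b c))) (sym (ℤ.pos-+ (a * d) _)))

  powᶻ-ℕ√ : ∀ {A B} → 1 ≤ A → ∀ n → ∃₂ λ r s → powᶻ p (ℕ√ A B) n ≡ ℕ√ r s × 1 ≤ r
  powᶻ-ℕ√ _ zero = 1 , 0 , refl , ≤-refl
  powᶻ-ℕ√ {A} {B} 1≤A (suc n) =
    let r , s , εⁿ≡ℕ√rs , 1≤r = powᶻ-ℕ√ 1≤A n
    in _ , _ , trans (cong (ℕ√ A B ·_) εⁿ≡ℕ√rs) (ℕ√-· A B r s)
     , ≤-trans (*-mono-≤ 1≤A 1≤r) (m≤m+n _ _)

  fundamental-unit-minimal : ∀ {A B S T} → 1 ≤ A → IsFundamentalUnit p (ℕ√ A B) →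
    IsUnit p (ℕ√ S T) → 1 ≤ T → S < A → ⊥
  fundamental-unit-minimal {A} {B} {S} {T} 1≤A (_ , _ , ±εⁿ) η-unit 1≤T S<A with ±εⁿ (ℕ√ S T) η-unit
  ... | zero , inj₁ η≡1 with ℤ.+-injective (cong im η≡1)
  ...   | refl = case 1≤T of λ ()
  fundamental-unit-minimal {A} {B} {S} {T} 1≤A _ _ 1≤T S<A | suc n , inj₁ η≡εεⁿ with powᶻ-ℕ√ {B = B} 1≤A n
  ...   | r , s , εⁿ≡ℕ√rs , 1≤r = <-irrefl S≡Ar+pBs (<-≤-trans S<A A≤Ar+pBs)
    where
    S≡Ar+pBs : S ≡ A * r + p * (B * s)
    S≡Ar+pBs = ℤ.+-injective (cong re (trans η≡εεⁿ (trans (cong (ℕ√ A B ·_) εⁿ≡ℕ√rs) (ℕ√-· A B r s))))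
    A≤Ar+pBs : A ≤ A * r + p * (B * s)
    A≤Ar+pBs = ≤-trans (≤-trans (≤-reflexive (sym (*-identityʳ A))) (*-monoʳ-≤ A 1≤r)) (m≤m+n _ _)
  fundamental-unit-minimal {A} {B} 1≤A _ _ _ _ | n , inj₂ (inj₁ η≡-εⁿ) with powᶻ-ℕ√ {B = B} 1≤A n
  ...   | suc r , s , εⁿ≡ℕ√rs , _ = case trans η≡-εⁿ (cong (negᶻ p) εⁿ≡ℕ√rs) of λ ()
  fundamental-unit-minimal {A} {B} {S} {T} 1≤A _ _ 1≤T _ | n , inj₂ (inj₂ ηεⁿ≡±1) with powᶻ-ℕ√ {B = B} 1≤A n
  ...   | r , s , εⁿ≡ℕ√rs , 1≤r = case subst (1 ≤_) Tr≡0 (*-mono-≤ 1≤T 1≤r) of λ ()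
    where
    Ss+Tr≡0 : S * s + T * r ≡ 0
    Ss+Tr≡0 = ℤ.+-injective (trans (cong im (sym (trans (cong (ℕ√ S T ·_) εⁿ≡ℕ√rs) (ℕ√-· S T r s))))
                                   (Sum.[ cong im , cong im ] ηεⁿ≡±1))
    Tr≡0 : T * r ≡ 0
    Tr≡0 = m+n≡0⇒n≡0 (S * s) Ss+Tr≡0

  fundamental-unit-not-square : ∀ {A B S T} → 1 ≤ p → 1 ≤ B → IsFundamentalUnit p (ℕ√ A B) →
    IsUnit p (ℕ√ S T) → ℕ√ A B ≡ ℕ√ S T · ℕ√ S T → ⊥
  fundamental-unit-not-square {A} {B} {S} {zero} _ 1≤B _ _ ε≡η² =
    case trans (ℤ.+-injective (cong im (trans ε≡η² (ℕ√-· S 0 S 0)))) (+-identityʳ (S * 0)) of λ B≡S*0 →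
    case subst (1 ≤_) (trans B≡S*0 (*-zeroʳ S)) 1≤B of λ ()
  fundamental-unit-not-square {A} {B} {S} {T@(suc _)} 1≤p _ fund η-unit ε≡η² =
    fundamental-unit-minimal {S = S} {T = T} (≤-trans (s≤s z≤n) S<A) fund η-unit (s≤s z≤n) S<A
    where
    A≡S²+pT² : A ≡ S * S + p * (T * T)
    A≡S²+pT² = ℤ.+-injective (cong re (trans ε≡η² (ℕ√-· S T S T)))
    m≤m*m : ∀ m → m ≤ m * m
    m≤m*m zero = z≤n
    m≤m*m m@(suc _) = m≤m*n m m
    S<A : S < A
    S<A = subst (S <_) (sym A≡S²+pT²)
      (<-≤-trans (m<m+n S (*-mono-≤ 1≤p (s≤s z≤n))) (+-monoˡ-≤ _ (m≤m*m S)))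

  fundamental-unit-re-even : ∀ {A B} → Prime p → Odd p → 1 ≤ B → IsFundamentalUnit p (ℕ√ A B) →
    A * A ≡ suc (p * (B * B)) → ∃ λ k → A ≡ 2 * k
  fundamental-unit-re-even {A} {B} p-prime p-odd 1≤B fund A²≡1+pB² with evenOrOdd A
  ... | even k = k , refl
  ... | odd k =
    let S , T , η-norm , A≡S²+pT² , B≡2ST = pell-odd-square {p} {k} {B} p-prime p-odd A²≡1+pB²
    in ⊥-elim (fundamental-unit-not-square {S = S} {T = T} (>-nonZero⁻¹ p {{prime⇒nonZero p-prime}}) 1≤B fund
         (Norm±1⇒unit {ℕ√ S T} η-norm) (trans (cong₂ ℕ√ A≡S²+pT² B≡2ST) (sym (ℕ√-· S T S T))))

  -- Of the sign patterns allowed by RealGt1, b < 0 would need p b² < (a − 1)² and a ≤ 0 would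
  -- need (a − 1)² < p b²; both contradict a² = 1 + p b².
  norm1-gt1⇒positive : ∀ {a b} → ∣ a ∣ * ∣ a ∣ ≡ suc (p * (∣ b ∣ * ∣ b ∣)) → RealGt1 p (a + b √) →
    ∃₂ λ A B → a + b √ ≡ ℕ√ A (suc B)
  norm1-gt1⇒positive {+ zero} () _
  norm1-gt1⇒positive {+ suc n} {+ suc m} _ _ = suc n , m , refl
  norm1-gt1⇒positive {+ suc n} {+ zero} a²≡1+pb² gt1
    with m+n≡0⇒m≡0 n (trans (suc-injective a²≡1+pb²) (*-zeroʳ p))
  ... | refl = case gt1 of λ where
    (inj₁ (_ , _ , inj₁ (ℤ.+<+ ())))
    (inj₁ (_ , _ , inj₂ (ℤ.+<+ ())))
    (inj₂ (inj₁ (ℤ.+<+ () , _)))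
    (inj₂ (inj₂ (ℤ.+<+ () , _)))
  norm1-gt1⇒positive {+ suc n} { -[1+ m ]} _ (inj₁ (_ , () , _))
  norm1-gt1⇒positive {+ suc n} { -[1+ m ]} a²≡1+pb² (inj₂ (inj₁ (_ , _ , pb²<[a-1]²)))
    with subst₂ ℤ._<_ (sym (ℤ.pos-* p _)) (sym (ℤ.pos-* n n)) pb²<[a-1]²
  ... | ℤ.+<+ pb²<n² = ⊥-elim (<⇒≱ pb²<n² n²≤pb²)
    where
    open ≤-Reasoning
    n²≤pb² : n * n ≤ p * (suc m * suc m)
    n²≤pb² = begin
      n * n                ≤⟨ *-monoʳ-≤ n (n≤1+n n) ⟩
      n * suc n            ≤⟨ m≤n+m _ n ⟩
      n + n * suc n        ≡⟨ suc-injective a²≡1+pb² ⟩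
      p * (suc m * suc m)  ∎
  norm1-gt1⇒positive {+ suc n} { -[1+ m ]} _ (inj₂ (inj₂ (ℤ.+<+ () , _)))
  norm1-gt1⇒positive { -[1+ n ]} _ (inj₁ (() , _))
  norm1-gt1⇒positive { -[1+ n ]} _ (inj₂ (inj₁ (() , _)))
  norm1-gt1⇒positive { -[1+ n ]} { -[1+ m ]} _ (inj₂ (inj₂ (_ , () , _)))
  norm1-gt1⇒positive { -[1+ n ]} {+ B} a²≡1+pb² (inj₂ (inj₂ (_ , _ , [a-1]²<pb²)))
    with subst₂ ℤ._<_ (cong (λ k → + (suc (suc k) * suc (suc k))) (+-identityʳ n))
                       (trans (cong (+ p ℤ.*_) (sym (ℤ.pos-* B B))) (sym (ℤ.pos-* p _))) [a-1]²<pb²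
  ... | ℤ.+<+ [n+2]²<pb² = ⊥-elim (<-irrefl refl (begin-strict
      p * (B * B)              <⟨ ≤-reflexive (sym a²≡1+pb²) ⟩
      suc n * suc n            <⟨ *-mono-< (n<1+n (suc n)) (n<1+n (suc n)) ⟩
      suc (suc n) * suc (suc n) <⟨ [n+2]²<pb² ⟩
      p * (B * B)              ∎))
    where open ≤-Reasoning

fromℕ : ℕ → ℚ
fromℕ n = + n ℚ./ 1

toℚᵘ-fromℕ : ∀ n → ℚ.toℚᵘ (fromℕ n) ℚᵘ.≃ mkℚᵘ (+ n) 0
toℚᵘ-fromℕ n = ℚ.toℚᵘ-fromℚᵘ (mkℚᵘ (+ n) 0)

fromℕ-+ : ∀ m n → fromℕ (m + n) ≡ fromℕ m ℚ.+ fromℕ n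
fromℕ-+ m n = ℚ.toℚᵘ-injective (begin
  ℚ.toℚᵘ (fromℕ (m + n))                  ≈⟨ toℚᵘ-fromℕ (m + n) ⟩
  mkℚᵘ (+ (m + n)) 0                      ≈⟨ *≡* (cong (ℤ._* + 1) (trans (ℤ.pos-+ m n) (identity (+ m) (+ n)))) ⟩
  mkℚᵘ (+ m) 0 ℚᵘ.+ mkℚᵘ (+ n) 0          ≈⟨ ℚᵘ.+-cong (toℚᵘ-fromℕ m) (toℚᵘ-fromℕ n) ⟨
  ℚ.toℚᵘ (fromℕ m) ℚᵘ.+ ℚ.toℚᵘ (fromℕ n)  ≈⟨ ℚ.toℚᵘ-homo-+ (fromℕ m) (fromℕ n) ⟨
  ℚ.toℚᵘ (fromℕ m ℚ.+ fromℕ n)            ∎)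
  where
  open ℚᵘ.≃-Reasoning
  identity : ∀ i j → i ℤ.+ j ≡ i ℤ.* + 1 ℤ.+ j ℤ.* + 1
  identity = ℤ-Solver.solve-∀

fromℕ-* : ∀ m n → fromℕ (m * n) ≡ fromℕ m ℚ.* fromℕ n
fromℕ-* m n = ℚ.toℚᵘ-injective (begin
  ℚ.toℚᵘ (fromℕ (m * n))                  ≈⟨ toℚᵘ-fromℕ (m * n) ⟩
  mkℚᵘ (+ (m * n)) 0                      ≈⟨ *≡* (cong (ℤ._* + 1) (ℤ.pos-* m n)) ⟩
  mkℚᵘ (+ m) 0 ℚᵘ.* mkℚᵘ (+ n) 0          ≈⟨ ℚᵘ.*-cong (toℚᵘ-fromℕ m) (toℚᵘ-fromℕ n) ⟨
  ℚ.toℚᵘ (fromℕ m) ℚᵘ.* ℚ.toℚᵘ (fromℕ n)  ≈⟨ ℚ.toℚᵘ-homo-* (fromℕ m) (fromℕ n) ⟨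
  ℚ.toℚᵘ (fromℕ m ℚ.* fromℕ n)            ∎)
  where open ℚᵘ.≃-Reasoning

half-odd-offset : ∀ i → ½ ℚ.* fromℕ (1 + 2 * i) ℚ.- ½ ≡ + i ℚ./ 1
half-odd-offset i = begin
  ½ ℚ.* fromℕ (1 + 2 * i) ℚ.- ½
    ≡⟨ cong (λ x → ½ ℚ.* x ℚ.- ½) (trans (fromℕ-+ 1 (2 * i)) (cong (1ℚ ℚ.+_) (fromℕ-* 2 i))) ⟩
  ½ ℚ.* (1ℚ ℚ.+ fromℕ 2 ℚ.* fromℕ i) ℚ.- ½
    ≡⟨ identity ½ (fromℕ 2) (fromℕ i) ⟩
  (½ ℚ.* fromℕ 2) ℚ.* fromℕ i
    ≡⟨ ℚ.*-identityˡ (fromℕ i) ⟩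
  fromℕ i ∎
  where
  open ≡-Reasoning
  open +-*-Solver
  identity : ∀ h c x → h ℚ.* (1ℚ ℚ.+ c ℚ.* x) ℚ.- h ≡ (h ℚ.* c) ℚ.* x
  identity = solve 3 (λ h c x → h :* (con 1ℚ :+ c :* x) :- h := (h :* c) :* x) refl

module _ (p : ℕ) where

  half-ℕ√ : ℕ → ℕ → F√
  half-ℕ√ s t = (½ ℚ.* fromℕ s) + (½ ℚ.* fromℕ t) √F

  half-ℕ√-square : ∀ {A B} s t → s * s + p * (t * t) ≡ A + A → s * t ≡ B →
    _*F_ p (half-ℕ√ s t) (half-ℕ√ s t) ≡ half (ι (ℕ√ A B))
  half-ℕ√-square {A} {B} s t norm≡2A st≡B = cong₂ _+_√F re-eq im-eq
    where
    open ≡-Reasoning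
    open +-*-Solver
    ½*½+½*½≡½ : ½ ℚ.* ½ ℚ.+ ½ ℚ.* ½ ≡ ½
    ½*½+½*½≡½ = refl
    re-eq : (½ ℚ.* fromℕ s) ℚ.* (½ ℚ.* fromℕ s) ℚ.+ fromℕ p ℚ.* ((½ ℚ.* fromℕ t) ℚ.* (½ ℚ.* fromℕ t))
          ≡ ½ ℚ.* fromℕ A
    re-eq = begin
      (½ ℚ.* fromℕ s) ℚ.* (½ ℚ.* fromℕ s) ℚ.+ fromℕ p ℚ.* ((½ ℚ.* fromℕ t) ℚ.* (½ ℚ.* fromℕ t))
        ≡⟨ factor ½ (fromℕ s) (fromℕ t) (fromℕ p) ⟩
      (½ ℚ.* ½) ℚ.* (fromℕ s ℚ.* fromℕ s ℚ.+ fromℕ p ℚ.* (fromℕ t ℚ.* fromℕ t))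
        ≡⟨ cong ((½ ℚ.* ½) ℚ.*_) norm≡2A′ ⟩
      (½ ℚ.* ½) ℚ.* (fromℕ A ℚ.+ fromℕ A)
        ≡⟨ double ½ (fromℕ A) ⟩
      (½ ℚ.* ½ ℚ.+ ½ ℚ.* ½) ℚ.* fromℕ A
        ≡⟨ cong (ℚ._* fromℕ A) ½*½+½*½≡½ ⟩
      ½ ℚ.* fromℕ A ∎
      where
      factor : ∀ h x y P → (h ℚ.* x) ℚ.* (h ℚ.* x) ℚ.+ P ℚ.* ((h ℚ.* y) ℚ.* (h ℚ.* y))
                         ≡ (h ℚ.* h) ℚ.* (x ℚ.* x ℚ.+ P ℚ.* (y ℚ.* y))
      factor = solve 4 (λ h x y P → (h :* x) :* (h :* x) :+ P :* ((h :* y) :* (h :* y))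
                                 := (h :* h) :* (x :* x :+ P :* (y :* y))) refl
      double : ∀ h x → (h ℚ.* h) ℚ.* (x ℚ.+ x) ≡ (h ℚ.* h ℚ.+ h ℚ.* h) ℚ.* x
      double = solve 2 (λ h x → (h :* h) :* (x :+ x) := (h :* h :+ h :* h) :* x) refl
      norm≡2A′ : fromℕ s ℚ.* fromℕ s ℚ.+ fromℕ p ℚ.* (fromℕ t ℚ.* fromℕ t) ≡ fromℕ A ℚ.+ fromℕ A
      norm≡2A′ = begin
        fromℕ s ℚ.* fromℕ s ℚ.+ fromℕ p ℚ.* (fromℕ t ℚ.* fromℕ t)
          ≡⟨ cong₂ ℚ._+_ (fromℕ-* s s) (trans (fromℕ-* p (t * t)) (cong (fromℕ p ℚ.*_) (fromℕ-* t t))) ⟨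
        fromℕ (s * s) ℚ.+ fromℕ (p * (t * t))
          ≡⟨ fromℕ-+ (s * s) (p * (t * t)) ⟨
        fromℕ (s * s + p * (t * t))
          ≡⟨ cong fromℕ norm≡2A ⟩
        fromℕ (A + A)
          ≡⟨ fromℕ-+ A A ⟩
        fromℕ A ℚ.+ fromℕ A ∎
    im-eq : (½ ℚ.* fromℕ s) ℚ.* (½ ℚ.* fromℕ t) ℚ.+ (½ ℚ.* fromℕ t) ℚ.* (½ ℚ.* fromℕ s)
          ≡ ½ ℚ.* fromℕ B
    im-eq = begin
      (½ ℚ.* fromℕ s) ℚ.* (½ ℚ.* fromℕ t) ℚ.+ (½ ℚ.* fromℕ t) ℚ.* (½ ℚ.* fromℕ s)
        ≡⟨ factor ½ (fromℕ s) (fromℕ t) ⟩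
      (½ ℚ.* ½ ℚ.+ ½ ℚ.* ½) ℚ.* (fromℕ s ℚ.* fromℕ t)
        ≡⟨ cong₂ ℚ._*_ ½*½+½*½≡½ (trans (sym (fromℕ-* s t)) (cong fromℕ st≡B)) ⟩
      ½ ℚ.* fromℕ B ∎
      where
      factor : ∀ h x y → (h ℚ.* x) ℚ.* (h ℚ.* y) ℚ.+ (h ℚ.* y) ℚ.* (h ℚ.* x)
                       ≡ (h ℚ.* h ℚ.+ h ℚ.* h) ℚ.* (x ℚ.* y)
      factor = solve 3 (λ h x y → (h :* x) :* (h :* y) :+ (h :* y) :* (h :* x)
                               := (h :* h :+ h :* h) :* (x :* y)) refl

  half-ℕ√-sqrt : ∀ {k B} → Prime p → (2 * k) * (2 * k) ≡ suc (p * (B * B)) →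
    ∃ λ δ → _*F_ p δ δ ≡ half (ι (ℕ√ (2 * k) B)) × InO (δ -F halfOnePlusSqrt)
  half-ℕ√-sqrt {k} {B} p-prime A²≡1+pB² =
    let i , j , s²+pt²≡2A , st≡B = pell-even-split {p} {k} {B} p-prime A²≡1+pB²
    in half-ℕ√ (1 + 2 * i) (1 + 2 * j) , half-ℕ√-square {2 * k} {B} (1 + 2 * i) (1 + 2 * j) s²+pt²≡2A st≡B
       , (+ i , half-odd-offset i) , (+ j , half-odd-offset j)

proposition2p5 : (p : ℕ) → Prime p → p % 4 ≡ 3 →
    (ε : ℤ√) → IsFundamentalUnit p ε →
    ∃ λ (δ : F√) → _*F_ p δ δ ≡ half (ι ε) × InO (δ -F halfOnePlusSqrt)
proposition2p5 p p-prime p%4≡3 (a + b √) fund@(ε-unit , ε>1 , _) with unit⇒Norm±1 p {a + b √} ε-unit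
... | inj₂ pb²≡1+a² = ⊥-elim (1+square≢[3mod4]*square {p} p%4≡3 ∣ a ∣ ∣ b ∣ (sym pb²≡1+a²))
... | inj₁ a²≡1+pb² with norm1-gt1⇒positive p {a} {b} a²≡1+pb² ε>1
... | A , B , refl with fundamental-unit-re-even p p-prime ([3mod4]⇒odd p%4≡3) (s≤s z≤n) fund a²≡1+pb²
... | k , refl = half-ℕ√-sqrt p {k} {suc B} p-prime a²≡1+pb²
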